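{- For $k$ an even power of $2$, the addressing function $\mathsf{ADD}_k$ satisfies: (1) $|O_{\alpha+\beta}|\ge\sqrt{k}$ for every pair of distinct $\alpha,\beta$ in its Fourier support; in particular $\mathsf{ADD}_k$ is $(1,\ell_k)$-folding with $\ell_k=\log_k(\sqrt{k}-1)=1/2-o(1)$; (2) for every constant $\delta>0$ and every $\ell\ge1/2$, $\mathsf{ADD}_k$ is not $(\delta,\ell)$-folding for all sufficiently large $k$.
   Context: Let $k$ be an even power of 2. $\mathsf{ADD}_k:\mathbb{F}_2^{\frac12\log k+\sqrt k}\to\{ -1,1\}$ is defined by $\mathsf{ADD}_k(x,y_1,\dots,y_{\sqrt k})=(-1)^{y_{\mathrm{int}(x)}}$, where $x\in\mathbb{F}_2^{\frac12\log k}$, $y_i\in\mathbb{F}_2$, and $\mathrm{int}(x)\in\{1,\dots,\sqrt k\}$ is the integer whose binary representation is $x$ (its Fourier sparsity is $k$). For $\alpha\in\mathbb{F}_2^m$ let $\chi_\alpha(x)=(-1)^{\sum_i\alpha_ix_i}$; every $f:\mathbb{F}_2^m\to\mathbb{R}$ is uniquely $f=\sum_\alpha\widehat f(\alpha)\chi_\alpha$; the Fourier support is $\mathcal{S}=\{\alpha:\widehat f(\alpha)\ne0\}$ and $k=|\mathcal{S}|$. $O_\gamma$ is the set of unordered pairs of distinct elements of $\mathcal{S}$ summing to $\gamma$. $f$ is $(\delta,\ell)$-folding if at least $\delta\binom{k}{2}$ unordered pairs $\{\alpha,\beta\}$ of distinct elements of $\mathcal{S}$ satisfy $|O_{\alpha+\beta}|\ge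 k^\ell+1$.
   Formalization: In part (2), the constant δ and the exponent ℓ range over the rationals. -}

module Defs where

open import Data.Bool using (Bool; true; false; _xor_; if_then_else_)
open import Data.Nat as ℕ using (ℕ; zero; suc; _+_; _*_; _∸_; _^_; _≤_; _≤?_)
open import Data.Nat.Properties using (m^n≢0)
open import Data.Nat.Combinatorics using (_C_)
open import Data.Integer as ℤ using (ℤ; +_; -_)
open import Data.Rational as ℚ using (ℚ; 0ℚ; _/_)
import Data.Rational.Properties as ℚP
open import Data.List as L using (List; []; _∷_; length; filter; concatMap; map; foldr)
open import Data.Vec as V using (Vec; []; _∷_; take; drop; zipWith)
open import Data.Product using (_×_; _,_; proj₁; proj₂)
open import Relation.Nullary using (¬_; Dec; ¬?)
open import Relation.Unary using (Decidable)
open import Relation.Binary.PropositionalEquality using (_≡_)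
import Data.Bool
import Data.Vec.Properties as VP

-- F₂ⁿ is modelled as Vec Bool n (true = 1), addition is pointwise xor.

_⊕_ : ∀ {n} → Vec Bool n → Vec Bool n → Vec Bool n
_⊕_ = zipWith _xor_

allVecs : (n : ℕ) → List (Vec Bool n)
allVecs zero    = [] ∷ []
allVecs (suc n) = map (false ∷_) (allVecs n) L.++ map (true ∷_) (allVecs n)

dot : ∀ {n} → Vec Bool n → Vec Bool n → Bool
dot []      []      = false
dot (a ∷ α) (b ∷ x) = (if a then b else false) xor dot α x

χ : ∀ {n} → Vec Bool n → Vec Bool n → ℤ
χ α x = if dot α x then - (+ 1) else + 1

sumℤ : List ℤ → ℤ
sumℤ = foldr ℤ._+_ (+ 0)

fhat : ∀ {n} → (Vec Bool n → ℤ) → Vec Bool n → ℚ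
fhat {n} f α = _/_ (sumℤ (map (λ x → f x ℤ.* χ α x) (allVecs n))) (2 ^ n) {{m^n≢0 2 n}}

support : ∀ {n} → (Vec Bool n → ℤ) → List (Vec Bool n)
support {n} f = filter (λ α → ¬? (fhat f α ℚP.≟ 0ℚ)) (allVecs n)

sparsity : ∀ {n} → (Vec Bool n → ℤ) → ℕ
sparsity f = length (support f)

-- For a repetition-free list [a₀,…,a_{m-1}], the list of pairs (aᵢ,aⱼ), i<j,
-- i.e. one representative for each unordered pair of distinct elements.
unorderedPairs : ∀ {A : Set} → List A → List (A × A)
unorderedPairs []       = []
unorderedPairs (a ∷ as) = map (a ,_) as L.++ unorderedPairs as

_≟v_ : ∀ {n} (u v : Vec Bool n) → Dec (u ≡ v)
_≟v_ = VP.≡-dec Data.Bool._≟_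

O-size : ∀ {n} → (Vec Bool n → ℤ) → Vec Bool n → ℕ
O-size f γ = length (filter (λ p → (proj₁ p ⊕ proj₂ p) ≟v γ) (unorderedPairs (support f)))

-- Generic folding with threshold predicate "Big o" standing for  o ≥ k^ℓ + 1:
-- at least δ·C(k,2) unordered pairs {α,β} of distinct elements of S have
-- Big |O_{α+β}|.
FoldingWith : ∀ {n} → (Vec Bool n → ℤ) → ℚ → (Big : ℕ → Set) → Decidable Big → Set
FoldingWith f δ Big Big? =
  δ ℚ.* ((+ (sparsity f C 2)) / 1)
    ℚ.≤ (+ length (filter (λ p → Big? (O-size f (proj₁ p ⊕ proj₂ p))) (unorderedPairs (support f)))) / 1

-- (δ,ℓ)-folding for a rational exponent ℓ = p/q (q ≥ 1):
--   o ≥ k^{p/q} + 1  ⇔  (o ∸ 1)^q ≥ k^p   (for k ≥ 1; if k = 0 there are no pairs)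
Folding : ∀ {n} → (Vec Bool n → ℤ) → (δ : ℚ) → (p q : ℕ) → Set
Folding f δ p q =
  FoldingWith f δ (λ o → sparsity f ^ p ≤ (o ∸ 1) ^ q) (λ o → sparsity f ^ p ≤? (o ∸ 1) ^ q)

-- The addressing function ADD_k for k = 4^t = 2^{2t}:
-- x ∈ F₂^t (t = ½ log k), y ∈ F₂^{2^t} (2^t = √k).

-- y_{int(x)}, where int(x) − 1 is the binary number x (first bit most significant)
address : ∀ {A : Set} (t : ℕ) → Vec Bool t → Vec A (2 ^ t) → A
address zero    []          (a ∷ []) = a
address (suc t) (false ∷ x) y = address t x (take (2 ^ t) y)
address (suc t) (true  ∷ x) y = address t x (take (2 ^ t) (drop (2 ^ t) y))

ADD : (t : ℕ) → Vec Bool (t + 2 ^ t) → ℤ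
ADD t z = if address t (take t z) (drop t z) then - (+ 1) else + 1

-- The Fourier support of ADD t consists of the characters (A , e_x), where A, x ∈ F₂ᵗ and e_x is
-- the basis vector of F₂^(2ᵗ) at position x: the character sum of ADD t at (A , U) factorises as
-- Σ_x (-1)^⟨A,x⟩ Σ_y (-1)^⟨e_x + U , y⟩, and the inner sum vanishes unless U = e_x.
-- Call x the slot of (A , e_x). If α, β have different slots a ≠ b, the pairs with sum
-- α + β = (D , e_a + e_b) are exactly the 2ᵗ = √k pairs {(T , e_a) , (T + D , e_b)}; if they share
-- a slot, the pairs {(A , e_c) , (B , e_c)} already give 2ᵗ of them.
-- For (2), |O| ≥ k^ℓ + 1 with ℓ ≥ 1/2 forces |O| > 2ᵗ, so only pairs with a common slot count;
-- there are at most 2^(3t) = k^(3/4) of them, fewer than δ·C(k,2) as soon as 2ᵗ ≥ 2d + 2, where d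
-- is the denominator of δ (so that δ ≥ 1/d).

module Submission where

open import Defs
open import Data.Nat using (ℕ; _+_; _*_; _^_; _≤_; _≤?_)
open import Data.Rational using (ℚ; 0ℚ; 1ℚ) renaming (_<_ to _<ℚ_)
open import Data.Vec using (Vec)
open import Data.Bool using (Bool)
open import Data.List.Membership.Propositional using (_∈_)
open import Data.Product using (_×_; ∃-syntax)
open import Relation.Binary.PropositionalEquality using (_≢_)
open import Relation.Nullary using (¬_)

open import Algebra.Bundles using (CommutativeRing)
open import Data.Bool using (true; false; not; _∧_; _xor_; if_then_else_)
open import Data.Bool.Properties
  using ( xor-comm; xor-assoc; xor-same; xor-identityʳ; ∧-distribˡ-xor; ∧-distribʳ-xor; ∧-zeroʳ
        ; xor-∧-commutativeRing )
open import Data.Empty using (⊥; ⊥-elim)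
open import Data.Fin as Fin using (Fin)
open import Data.Fin.Properties using (injective⇒≤)
open import Data.Integer as ℤ using (ℤ; -_; 0ℤ; 1ℤ)
import Data.Integer.Properties as ℤ
open import Data.Integer.GCD using (gcd)
open import Data.List using (List; []; _∷_; length; lookup; map; filter; _++_)
open import Data.List.Properties using (length-++; length-map; map-∘; map-cong; filter-all)
open import Data.List.Membership.Propositional.Properties
  using (∈-lookup; ∈-map⁺; ∈-map⁻; ∈-++⁺ˡ; ∈-++⁺ʳ; ∈-++⁻; ∈-filter⁺; ∈-filter⁻)
open import Data.List.Relation.Unary.All as All using ()
open import Data.List.Relation.Unary.AllPairs using ([]; _∷_)
open import Data.List.Relation.Unary.Any using (here; there; index)
open import Data.List.Relation.Unary.Any.Properties using (lookup-index)
open import Data.List.Relation.Unary.Unique.Propositional using (Unique)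
import Data.List.Relation.Unary.Unique.Propositional.Properties as Unique
open import Data.Nat as ℕ using (zero; suc; _∸_; _<_; z≤n; s≤s; NonZero)
open import Data.Nat.Properties
  using ( +-assoc; +-identityʳ; +-mono-≤; +-monoˡ-≤; +-cancelˡ-≤; *-assoc; *-identityʳ; *-distribˡ-+
        ; *-mono-≤; *-monoˡ-≤; *-monoʳ-≤; ^-*-assoc; ^-distribˡ-+-*; ^-monoˡ-≤; ^-monoʳ-≤; ^-monoˡ-<
        ; ∸-monoˡ-≤; ≤-reflexive; ≤-trans; ≤-antisym; <⇒≱; ≰⇒>; m<m+n; m≤n+m; m≤n*m; m^n≢0; m^n>0
        ; module ≤-Reasoning )
open import Data.Nat.Combinatorics using (_C_; nC1≡n; nCk+nC[k+1]≡[n+1]C[k+1])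
open import Data.Nat.Solver using (module +-*-Solver)
open import Data.Product as Prod using (_,_; proj₁; proj₂; swap)
open import Data.Rational as ℚ using (mkℚ; toℚᵘ; _/_; ↥_; ↧ₙ_)
import Data.Rational.Properties as ℚ
open import Data.Rational.Unnormalised as ℚᵘ using (mkℚᵘ; *≤*)
import Data.Rational.Unnormalised.Properties as ℚᵘ
open import Data.Sum using (_⊎_; inj₁; inj₂; [_,_]′)
open import Data.Vec as Vec using ([]; _∷_; replicate; take; drop; splitAt)
import Data.Vec.Properties as Vec
open import Function using (_∘_)
open import Relation.Binary.PropositionalEquality
  using (_≡_; refl; sym; trans; cong; cong₂; subst; subst₂; module ≡-Reasoning)
open import Relation.Nullary using (yes; no; ¬?)
open import Relation.Unary using (Decidable)

open import Algebra.Properties.CommutativeSemigroup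
  (CommutativeRing.+-commutativeSemigroup xor-∧-commutativeRing) using (interchange)
open import Algebra.Properties.CommutativeSemigroup ℤ.*-commutativeSemigroup using (x∙yz≈y∙xz)
open +-*-Solver using (solve; _:+_; _:*_; _:=_; con)

private
  variable
    X Y : Set
    m n : ℕ

-- Counting by injections; unordered pairs

Unique⇒lookup-injective : ∀ {xs : List X} → Unique xs → ∀ {i j} → lookup xs i ≡ lookup xs j → i ≡ j
Unique⇒lookup-injective (_ ∷ _)     {Fin.zero}  {Fin.zero}  _  = refl
Unique⇒lookup-injective (x≢xs ∷ _)  {Fin.zero}  {Fin.suc j} eq = ⊥-elim (All.lookup x≢xs (∈-lookup j) eq)
Unique⇒lookup-injective (x≢xs ∷ _)  {Fin.suc i} {Fin.zero}  eq = ⊥-elim (All.lookup x≢xs (∈-lookup i) (sym eq))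
Unique⇒lookup-injective (_ ∷ uniq)  {Fin.suc i} {Fin.suc j} eq = cong Fin.suc (Unique⇒lookup-injective uniq eq)

length-≤-injectiveOn : ∀ {xs : List X} {ys : List Y} (f : X → Y) → Unique xs →
                       (∀ {x y} → x ∈ xs → y ∈ xs → f x ≡ f y → x ≡ y) →
                       (∀ {x} → x ∈ xs → f x ∈ ys) → length xs ≤ length ys
length-≤-injectiveOn {xs = xs} {ys} f uniq inj into = injective⇒≤ position-injective
  where
  position : Fin (length xs) → Fin (length ys)
  position i = index (into (∈-lookup i))

  position-injective : ∀ {i j} → position i ≡ position j → i ≡ j
  position-injective {i} {j} eq = Unique⇒lookup-injective uniq (inj (∈-lookup i) (∈-lookup j) (begin
    f (lookup xs i)        ≡⟨ lookup-index (into (∈-lookup i)) ⟩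
    lookup ys (position i) ≡⟨ cong (lookup ys) eq ⟩
    lookup ys (position j) ≡⟨ lookup-index (into (∈-lookup j)) ⟨
    f (lookup xs j)        ∎))
    where open ≡-Reasoning


∈-unorderedPairs-∷⁻ : ∀ {x} {xs : List X} {a b} → (a , b) ∈ unorderedPairs (x ∷ xs) →
                      (a ≡ x × b ∈ xs) ⊎ (a , b) ∈ unorderedPairs xs
∈-unorderedPairs-∷⁻ {x = x} {xs} p∈ with ∈-++⁻ (map (x ,_) xs) p∈
... | inj₂ p∈′ = inj₂ p∈′
... | inj₁ p∈′ with ∈-map⁻ (x ,_) p∈′
...   | _ , y∈ , refl = inj₁ (refl , y∈)

∈-unorderedPairs⁻ : ∀ {L : List X} {a b} → (a , b) ∈ unorderedPairs L → a ∈ L × b ∈ L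
∈-unorderedPairs⁻ {L = x ∷ xs} p∈ with ∈-unorderedPairs-∷⁻ {x = x} {xs} p∈
... | inj₁ (refl , y∈) = here refl , there y∈
... | inj₂ p∈′         = Prod.map there there (∈-unorderedPairs⁻ p∈′)

∈-unorderedPairs⁺ : ∀ {L : List X} {a b} → a ∈ L → b ∈ L → a ≢ b →
                    (a , b) ∈ unorderedPairs L ⊎ (b , a) ∈ unorderedPairs L
∈-unorderedPairs⁺ (here refl) (here refl) a≢b = ⊥-elim (a≢b refl)
∈-unorderedPairs⁺ (here refl) (there b∈)  _   = inj₁ (∈-++⁺ˡ (∈-map⁺ _ b∈))
∈-unorderedPairs⁺ (there a∈)  (here refl) _   = inj₂ (∈-++⁺ˡ (∈-map⁺ _ a∈))
∈-unorderedPairs⁺ {L = x ∷ xs} (there a∈) (there b∈) a≢b with ∈-unorderedPairs⁺ a∈ b∈ a≢b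
... | inj₁ p∈ = inj₁ (∈-++⁺ʳ (map (x ,_) xs) p∈)
... | inj₂ p∈ = inj₂ (∈-++⁺ʳ (map (x ,_) xs) p∈)

unorderedPairs-irreflexive : ∀ {L : List X} → Unique L → ∀ {a b} → (a , b) ∈ unorderedPairs L → a ≢ b
unorderedPairs-irreflexive {L = x ∷ xs} (_ ∷ uniq) p∈ with ∈-unorderedPairs-∷⁻ {x = x} {xs} p∈
... | inj₂ p∈′ = unorderedPairs-irreflexive uniq p∈′
unorderedPairs-irreflexive (x≢xs ∷ _) _ | inj₁ (refl , y∈) = All.lookup x≢xs y∈

unorderedPairs-asymmetric : ∀ {L : List X} → Unique L → ∀ {a b} →
                            (a , b) ∈ unorderedPairs L → (b , a) ∈ unorderedPairs L → ⊥
unorderedPairs-asymmetric {L = x ∷ xs} uniq@(_ ∷ uniq′) p∈ q∈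
  with ∈-unorderedPairs-∷⁻ {x = x} {xs} p∈ | ∈-unorderedPairs-∷⁻ {x = x} {xs} q∈
... | inj₁ (refl , x∈) | inj₁ (refl , _)  = Unique.Unique[x∷xs]⇒x∉xs uniq x∈
... | inj₁ (refl , _)  | inj₂ q∈′         = Unique.Unique[x∷xs]⇒x∉xs uniq (proj₂ (∈-unorderedPairs⁻ q∈′))
... | inj₂ p∈′         | inj₁ (refl , _)  = Unique.Unique[x∷xs]⇒x∉xs uniq (proj₂ (∈-unorderedPairs⁻ p∈′))
... | inj₂ p∈′         | inj₂ q∈′         = unorderedPairs-asymmetric uniq′ p∈′ q∈′

unorderedPairs-unique : ∀ {L : List X} → Unique L → Unique (unorderedPairs L)
unorderedPairs-unique {L = []}     _                 = []
unorderedPairs-unique {L = x ∷ xs} uniq@(_ ∷ uniq′) =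
  Unique.++⁺ (Unique.map⁺ (cong proj₂) uniq′) (unorderedPairs-unique uniq′) disjoint
  where
  disjoint : ∀ {p} → ¬ (p ∈ map (x ,_) xs × p ∈ unorderedPairs xs)
  disjoint (p∈ , q∈) with ∈-map⁻ (x ,_) p∈
  ... | _ , _ , refl = Unique.Unique[x∷xs]⇒x∉xs uniq (proj₁ (∈-unorderedPairs⁻ q∈))

length-unorderedPairs : ∀ (L : List X) → length (unorderedPairs L) ≡ length L C 2
length-unorderedPairs []       = refl
length-unorderedPairs (x ∷ xs) = begin
  length (map (x ,_) xs ++ unorderedPairs xs)        ≡⟨ length-++ (map (x ,_) xs) ⟩
  length (map (x ,_) xs) + length (unorderedPairs xs) ≡⟨ cong₂ _+_ (length-map (x ,_) xs) (length-unorderedPairs xs) ⟩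
  length xs + length xs C 2                          ≡⟨ cong (_+ length xs C 2) (nC1≡n (length xs)) ⟨
  length xs C 1 + length xs C 2                      ≡⟨ nCk+nC[k+1]≡[n+1]C[k+1] (length xs) 1 ⟩
  length (x ∷ xs) C 2                                ∎
  where open ≡-Reasoning

infix 4 _≈ᵤ_

_≈ᵤ_ : X × X → X × X → Set _
p ≈ᵤ q = p ≡ q ⊎ p ≡ swap q

≈ᵤ-sym : ∀ {p q : X × X} → p ≈ᵤ q → q ≈ᵤ p
≈ᵤ-sym (inj₁ refl) = inj₁ refl
≈ᵤ-sym (inj₂ refl) = inj₂ refl

≈ᵤ-trans : ∀ {p q r : X × X} → p ≈ᵤ q → q ≈ᵤ r → p ≈ᵤ r
≈ᵤ-trans (inj₁ refl) q≈r         = q≈r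
≈ᵤ-trans (inj₂ refl) (inj₁ refl) = inj₂ refl
≈ᵤ-trans (inj₂ refl) (inj₂ refl) = inj₁ refl

unorderedPairs-≈ᵤ⇒≡ : ∀ {L : List X} → Unique L → ∀ {p q} →
                      p ∈ unorderedPairs L → q ∈ unorderedPairs L → p ≈ᵤ q → p ≡ q
unorderedPairs-≈ᵤ⇒≡ _    _  _  (inj₁ p≡q)  = p≡q
unorderedPairs-≈ᵤ⇒≡ uniq p∈ q∈ (inj₂ refl) = ⊥-elim (unorderedPairs-asymmetric uniq q∈ p∈)

module _ {L : List X} (uniq : Unique L) {P : X × X → Set} (P? : Decidable P)
         {cs : List Y} (g : Y → X × X) where

  length-filter-unorderedPairs-≥ :
    Unique cs → (∀ {c d} → g c ≡ g d → c ≡ d) → (∀ c d → g c ≢ swap (g d)) →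
    (∀ c → proj₁ (g c) ∈ L × proj₂ (g c) ∈ L) → (∀ c → P (g c)) → (∀ {p} → P p → P (swap p)) →
    length cs ≤ length (filter P? (unorderedPairs L))
  length-filter-unorderedPairs-≥ uniq-cs g-injective g-unswapped g∈L Pg P-swap =
    length-≤-injectiveOn orient uniq-cs
      (λ {c} {d} _ _ eq → ≈ᵤ⇒≡ (≈ᵤ-trans (subst (g c ≈ᵤ_) eq (g≈ᵤorient c)) (≈ᵤ-sym (g≈ᵤorient d))))
      (λ {c} _ → ∈-filter⁺ P? (orient∈ c) (P-orient c))
    where
    g-distinct : ∀ c → proj₁ (g c) ≢ proj₂ (g c)
    g-distinct c eq = g-unswapped c c (cong₂ _,_ eq (sym eq))

    cover : ∀ c → g c ∈ unorderedPairs L ⊎ swap (g c) ∈ unorderedPairs L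
    cover c = ∈-unorderedPairs⁺ (proj₁ (g∈L c)) (proj₂ (g∈L c)) (g-distinct c)

    orient : Y → X × X
    orient c = [ (λ _ → g c) , (λ _ → swap (g c)) ]′ (cover c)

    orient∈ : ∀ c → orient c ∈ unorderedPairs L
    orient∈ c with cover c
    ... | inj₁ g∈ = g∈
    ... | inj₂ g∈ = g∈

    g≈ᵤorient : ∀ c → g c ≈ᵤ orient c
    g≈ᵤorient c with cover c
    ... | inj₁ _ = inj₁ refl
    ... | inj₂ _ = inj₂ refl

    P-orient : ∀ c → P (orient c)
    P-orient c with cover c
    ... | inj₁ _ = Pg c
    ... | inj₂ _ = P-swap (Pg c)

    ≈ᵤ⇒≡ : ∀ {c d} → g c ≈ᵤ g d → c ≡ d
    ≈ᵤ⇒≡ (inj₁ eq) = g-injective eq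
    ≈ᵤ⇒≡ (inj₂ eq) = ⊥-elim (g-unswapped _ _ eq)

  length-filter-unorderedPairs-≤ :
    (h : X × X → Y) → (∀ c → c ∈ cs) → (∀ {p} → p ∈ filter P? (unorderedPairs L) → p ≈ᵤ g (h p)) →
    length (filter P? (unorderedPairs L)) ≤ length cs
  length-filter-unorderedPairs-≤ h complete parametrised =
    length-≤-injectiveOn h (Unique.filter⁺ P? (unorderedPairs-unique uniq))
      (λ {p} {q} p∈ q∈ eq →
         unorderedPairs-≈ᵤ⇒≡ uniq (proj₁ (∈-filter⁻ P? p∈)) (proj₁ (∈-filter⁻ P? q∈))
         (≈ᵤ-trans (subst (λ c → p ≈ᵤ g c) eq (parametrised p∈)) (≈ᵤ-sym (parametrised q∈))))
      (λ _ → complete _)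

-- Vectors over F₂ and character sums

take-++ : ∀ (xs : Vec X m) (ys : Vec X n) → take m (xs Vec.++ ys) ≡ xs
take-++ {m = m} xs ys = sym (Vec.++-injectiveˡ xs _ (proj₂ (proj₂ (splitAt m (xs Vec.++ ys)))))

drop-++ : ∀ (xs : Vec X m) (ys : Vec X n) → drop m (xs Vec.++ ys) ≡ ys
drop-++ {m = m} xs ys = sym (Vec.++-injectiveʳ xs _ (proj₂ (proj₂ (splitAt m (xs Vec.++ ys)))))

take++drop : ∀ m (xs : Vec X (m + n)) → xs ≡ take m xs Vec.++ drop m xs
take++drop m xs = sym (Vec.take++drop≡id m xs)

0ᵥ : ∀ n → Vec Bool n
0ᵥ n = replicate n false

⊕-comm : ∀ (u v : Vec Bool n) → u ⊕ v ≡ v ⊕ u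
⊕-comm = Vec.zipWith-comm xor-comm

⊕-self : ∀ (u : Vec Bool n) → u ⊕ u ≡ 0ᵥ n
⊕-self []      = refl
⊕-self (a ∷ u) = cong₂ _∷_ (xor-same a) (⊕-self u)

u⊕[u⊕w]≡w : ∀ (u w : Vec Bool n) → u ⊕ (u ⊕ w) ≡ w
u⊕[u⊕w]≡w u w = begin
  u ⊕ (u ⊕ w)  ≡⟨ Vec.zipWith-assoc xor-assoc u u w ⟨
  (u ⊕ u) ⊕ w  ≡⟨ cong (_⊕ w) (⊕-self u) ⟩
  0ᵥ _ ⊕ w     ≡⟨ Vec.zipWith-identityˡ (λ _ → refl) w ⟩
  w            ∎
  where open ≡-Reasoning

u⊕v≡w⇒v≡u⊕w : ∀ {u v w : Vec Bool n} → u ⊕ v ≡ w → v ≡ u ⊕ w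
u⊕v≡w⇒v≡u⊕w {u = u} {v} refl = sym (u⊕[u⊕w]≡w u v)

⊕≡0⇒≡ : ∀ {u v : Vec Bool n} → u ⊕ v ≡ 0ᵥ n → u ≡ v
⊕≡0⇒≡ {u = u} eq = sym (trans (u⊕v≡w⇒v≡u⊕w eq) (Vec.zipWith-identityʳ xor-identityʳ u))

⊕-cancelˡ-≡ : ∀ {u v w : Vec Bool n} → u ⊕ v ≡ u ⊕ w → v ≡ w
⊕-cancelˡ-≡ {u = u} {w = w} eq = trans (u⊕v≡w⇒v≡u⊕w eq) (u⊕[u⊕w]≡w u w)

++-⊕ : ∀ (a : Vec Bool m) (b : Vec Bool n) (c : Vec Bool m) (d : Vec Bool n) →
       (a Vec.++ b) ⊕ (c Vec.++ d) ≡ (a ⊕ c) Vec.++ (b ⊕ d)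
++-⊕ = Vec.zipWith-++ _xor_

∈-allVecs : ∀ (v : Vec Bool n) → v ∈ allVecs n
∈-allVecs []          = here refl
∈-allVecs (false ∷ v) = ∈-++⁺ˡ (∈-map⁺ (false ∷_) (∈-allVecs v))
∈-allVecs (true ∷ v)  = ∈-++⁺ʳ (map (false ∷_) (allVecs _)) (∈-map⁺ (true ∷_) (∈-allVecs v))

allVecs-unique : ∀ n → Unique (allVecs n)
allVecs-unique zero    = All.[] ∷ []
allVecs-unique (suc n) =
  Unique.++⁺ (Unique.map⁺ Vec.∷-injectiveʳ (allVecs-unique n))
             (Unique.map⁺ Vec.∷-injectiveʳ (allVecs-unique n)) disjoint
  where
  disjoint : ∀ {v} → ¬ (v ∈ map (false ∷_) (allVecs n) × v ∈ map (true ∷_) (allVecs n))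
  disjoint (v∈ , v∈′) with ∈-map⁻ (false ∷_) v∈ | ∈-map⁻ (true ∷_) v∈′
  ... | _ , _ , refl | _ , _ , ()

length-allVecs : ∀ n → length (allVecs n) ≡ 2 ^ n
length-allVecs zero    = refl
length-allVecs (suc n) = begin
  length (map (false ∷_) (allVecs n) ++ map (true ∷_) (allVecs n))
    ≡⟨ length-++ (map (false ∷_) (allVecs n)) ⟩
  length (map (false ∷_) (allVecs n)) + length (map (true ∷_) (allVecs n))
    ≡⟨ cong₂ _+_ (length-map _ (allVecs n)) (length-map _ (allVecs n)) ⟩
  length (allVecs n) + length (allVecs n)
    ≡⟨ cong₂ _+_ (length-allVecs n) (trans (length-allVecs n) (sym (+-identityʳ (2 ^ n)))) ⟩
  2 ^ suc n ∎
  where open ≡-Reasoning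

dot-∷ : ∀ a b (α x : Vec Bool n) → dot (a ∷ α) (b ∷ x) ≡ (a ∧ b) xor dot α x
dot-∷ false _ _ _ = refl
dot-∷ true  _ _ _ = refl

dot-++ : ∀ (a : Vec Bool m) (b : Vec Bool n) (c : Vec Bool m) (d : Vec Bool n) →
         dot (a Vec.++ b) (c Vec.++ d) ≡ dot a c xor dot b d
dot-++ []      _ []      _ = refl
dot-++ (x ∷ a) b (y ∷ c) d = begin
  dot (x ∷ a Vec.++ b) (y ∷ c Vec.++ d)     ≡⟨ dot-∷ x y (a Vec.++ b) (c Vec.++ d) ⟩
  (x ∧ y) xor dot (a Vec.++ b) (c Vec.++ d) ≡⟨ cong ((x ∧ y) xor_) (dot-++ a b c d) ⟩
  (x ∧ y) xor (dot a c xor dot b d)         ≡⟨ xor-assoc (x ∧ y) _ _ ⟨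
  ((x ∧ y) xor dot a c) xor dot b d         ≡⟨ cong (_xor dot b d) (dot-∷ x y a c) ⟨
  dot (x ∷ a) (y ∷ c) xor dot b d           ∎
  where open ≡-Reasoning

dot-⊕ˡ : ∀ (u v w : Vec Bool n) → dot (u ⊕ v) w ≡ dot u w xor dot v w
dot-⊕ˡ []      []      []      = refl
dot-⊕ˡ (a ∷ u) (b ∷ v) (y ∷ w) = begin
  dot ((a xor b) ∷ (u ⊕ v)) (y ∷ w)                    ≡⟨ dot-∷ (a xor b) y (u ⊕ v) w ⟩
  ((a xor b) ∧ y) xor dot (u ⊕ v) w                     ≡⟨ cong₂ _xor_ (∧-distribʳ-xor y a b) (dot-⊕ˡ u v w) ⟩
  ((a ∧ y) xor (b ∧ y)) xor (dot u w xor dot v w)       ≡⟨ interchange (a ∧ y) _ _ _ ⟩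
  ((a ∧ y) xor dot u w) xor ((b ∧ y) xor dot v w)       ≡⟨ cong₂ _xor_ (dot-∷ a y u w) (dot-∷ b y v w) ⟨
  dot (a ∷ u) (y ∷ w) xor dot (b ∷ v) (y ∷ w)           ∎
  where open ≡-Reasoning

dot-⊕ʳ : ∀ (w u v : Vec Bool n) → dot w (u ⊕ v) ≡ dot w u xor dot w v
dot-⊕ʳ []      []      []      = refl
dot-⊕ʳ (y ∷ w) (a ∷ u) (b ∷ v) = begin
  dot (y ∷ w) ((a xor b) ∷ (u ⊕ v))                    ≡⟨ dot-∷ y (a xor b) w (u ⊕ v) ⟩
  (y ∧ (a xor b)) xor dot w (u ⊕ v)                     ≡⟨ cong₂ _xor_ (∧-distribˡ-xor y a b) (dot-⊕ʳ w u v) ⟩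
  ((y ∧ a) xor (y ∧ b)) xor (dot w u xor dot w v)       ≡⟨ interchange (y ∧ a) _ _ _ ⟩
  ((y ∧ a) xor dot w u) xor ((y ∧ b) xor dot w v)       ≡⟨ cong₂ _xor_ (dot-∷ y a w u) (dot-∷ y b w v) ⟨
  dot (y ∷ w) (a ∷ u) xor dot (y ∷ w) (b ∷ v)           ∎
  where open ≡-Reasoning

dot-0ˡ : ∀ (w : Vec Bool n) → dot (0ᵥ n) w ≡ false
dot-0ˡ []      = refl
dot-0ˡ (_ ∷ w) = dot-0ˡ w

dot-0ʳ : ∀ (w : Vec Bool n) → dot w (0ᵥ n) ≡ false
dot-0ʳ []      = refl
dot-0ʳ (a ∷ w) = trans (dot-∷ a false w (0ᵥ _)) (cong₂ _xor_ (∧-zeroʳ a) (dot-0ʳ w))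

∑ : List X → (X → ℤ) → ℤ
∑ xs g = sumℤ (map g xs)

∑-++ : ∀ (xs ys : List X) (g : X → ℤ) → ∑ (xs ++ ys) g ≡ ∑ xs g ℤ.+ ∑ ys g
∑-++ []       ys g = sym (ℤ.+-identityˡ (∑ ys g))
∑-++ (x ∷ xs) ys g = trans (cong (ℤ._+_ (g x)) (∑-++ xs ys g)) (sym (ℤ.+-assoc (g x) _ _))

∑-cong : ∀ (xs : List X) {g h : X → ℤ} → (∀ x → g x ≡ h x) → ∑ xs g ≡ ∑ xs h
∑-cong xs g≗h = cong sumℤ (map-cong g≗h xs)

∑-zero : ∀ (xs : List X) {g : X → ℤ} → (∀ {x} → x ∈ xs → g x ≡ 0ℤ) → ∑ xs g ≡ 0ℤ
∑-zero []       _  = refl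
∑-zero (x ∷ xs) g≡0 = cong₂ ℤ._+_ (g≡0 (here refl)) (∑-zero xs (g≡0 ∘ there))

∑-*ˡ : ∀ (xs : List X) c (g : X → ℤ) → ∑ xs (λ x → c ℤ.* g x) ≡ c ℤ.* ∑ xs g
∑-*ˡ []       c g = sym (ℤ.*-zeroʳ c)
∑-*ˡ (x ∷ xs) c g = trans (cong (ℤ._+_ (c ℤ.* g x)) (∑-*ˡ xs c g)) (sym (ℤ.*-distribˡ-+ c (g x) _))

∑-neg : ∀ (xs : List X) (g : X → ℤ) → ∑ xs (λ x → - g x) ≡ - ∑ xs g
∑-neg []       g = refl
∑-neg (x ∷ xs) g = trans (cong (ℤ._+_ (- g x)) (∑-neg xs g)) (sym (ℤ.neg-distrib-+ (g x) _))

∑-1 : ∀ (xs : List X) → ∑ xs (λ _ → 1ℤ) ≡ ℤ.+ length xs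
∑-1 []       = refl
∑-1 (x ∷ xs) = cong (ℤ._+_ 1ℤ) (∑-1 xs)

∑-single : ∀ {xs : List X} {x} {g : X → ℤ} → Unique xs → x ∈ xs →
           (∀ y → y ≢ x → g y ≡ 0ℤ) → ∑ xs g ≡ g x
∑-single {xs = x ∷ xs} {g = g} uniq (here refl) g≡0 = begin
  g x ℤ.+ ∑ xs g ≡⟨ cong (ℤ._+_ (g x)) (∑-zero xs (λ y∈ → g≡0 _ (λ { refl → x∉xs y∈ }))) ⟩
  g x ℤ.+ 0ℤ     ≡⟨ ℤ.+-identityʳ (g x) ⟩
  g x            ∎
  where
  open ≡-Reasoning
  x∉xs = Unique.Unique[x∷xs]⇒x∉xs uniq
∑-single {xs = y ∷ xs} {g = g} uniq@(_ ∷ uniq′) (there x∈) g≡0 = begin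
  g y ℤ.+ ∑ xs g ≡⟨ cong₂ ℤ._+_ (g≡0 y (λ { refl → y∉xs x∈ })) (∑-single uniq′ x∈ g≡0) ⟩
  0ℤ ℤ.+ g _     ≡⟨ ℤ.+-identityˡ _ ⟩
  g _            ∎
  where
  open ≡-Reasoning
  y∉xs = Unique.Unique[x∷xs]⇒x∉xs uniq

∑-allVecs-suc : ∀ n (g : Vec Bool (suc n) → ℤ) →
                ∑ (allVecs (suc n)) g ≡ ∑ (allVecs n) (g ∘ (false ∷_)) ℤ.+ ∑ (allVecs n) (g ∘ (true ∷_))
∑-allVecs-suc n g = trans (∑-++ (map (false ∷_) (allVecs n)) _ g)
  (cong₂ ℤ._+_ (cong sumℤ (sym (map-∘ (allVecs n)))) (cong sumℤ (sym (map-∘ (allVecs n)))))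

∑-allVecs-+ : ∀ m n (g : Vec Bool (m + n) → ℤ) →
              ∑ (allVecs (m + n)) g ≡ ∑ (allVecs m) (λ u → ∑ (allVecs n) (λ w → g (u Vec.++ w)))
∑-allVecs-+ zero    n g = sym (ℤ.+-identityʳ _)
∑-allVecs-+ (suc m) n g = begin
  ∑ (allVecs (suc m + n)) g
    ≡⟨ ∑-allVecs-suc (m + n) g ⟩
  ∑ (allVecs (m + n)) (g ∘ (false ∷_)) ℤ.+ ∑ (allVecs (m + n)) (g ∘ (true ∷_))
    ≡⟨ cong₂ ℤ._+_ (∑-allVecs-+ m n (g ∘ (false ∷_))) (∑-allVecs-+ m n (g ∘ (true ∷_))) ⟩
  ∑ (allVecs m) (λ u → ∑ (allVecs n) (λ w → g (false ∷ u Vec.++ w)))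
    ℤ.+ ∑ (allVecs m) (λ u → ∑ (allVecs n) (λ w → g (true ∷ u Vec.++ w)))
    ≡⟨ ∑-allVecs-suc m (λ u → ∑ (allVecs n) (λ w → g (u Vec.++ w))) ⟨
  ∑ (allVecs (suc m)) (λ u → ∑ (allVecs n) (λ w → g (u Vec.++ w)))
    ∎
  where open ≡-Reasoning

-- χ α x and ADD t z unfold to ε (dot α x) and ε (address t (take t z) (drop t z)).
ε : Bool → ℤ
ε b = if b then - 1ℤ else 1ℤ

ε-xor : ∀ a b → ε (a xor b) ≡ ε a ℤ.* ε b
ε-xor false false = refl
ε-xor false true  = refl
ε-xor true  false = refl
ε-xor true  true  = refl

ε-not : ∀ b → ε (not b) ≡ - ε b
ε-not false = refl
ε-not true  = refl

ε*≢0 : ∀ b m .{{_ : NonZero m}} → ε b ℤ.* ℤ.+ m ≢ 0ℤ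
ε*≢0 false (suc m) ()
ε*≢0 true  (suc m) ()

∑-character : ∀ {n} (v : Vec Bool n) → v ≢ 0ᵥ n → ∑ (allVecs n) (λ w → ε (dot v w)) ≡ 0ℤ
∑-character []          v≢0 = ⊥-elim (v≢0 refl)
∑-character (false ∷ v) v≢0 = begin
  ∑ (allVecs (suc _)) (λ w → ε (dot (false ∷ v) w))
    ≡⟨ ∑-allVecs-suc _ (λ w → ε (dot (false ∷ v) w)) ⟩
  ∑ (allVecs _) (λ w → ε (dot v w)) ℤ.+ ∑ (allVecs _) (λ w → ε (dot v w))
    ≡⟨ cong₂ ℤ._+_ (∑-character v (v≢0 ∘ cong (false ∷_))) (∑-character v (v≢0 ∘ cong (false ∷_))) ⟩
  0ℤ ∎
  where open ≡-Reasoning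
∑-character {suc n} (true ∷ v) _ = begin
  ∑ (allVecs (suc n)) (λ w → ε (dot (true ∷ v) w))
    ≡⟨ ∑-allVecs-suc n (λ w → ε (dot (true ∷ v) w)) ⟩
  Σv ℤ.+ ∑ (allVecs n) (λ w → ε (not (dot v w)))
    ≡⟨ cong (ℤ._+_ Σv) (trans (∑-cong (allVecs n) (ε-not ∘ dot v)) (∑-neg (allVecs n) (ε ∘ dot v))) ⟩
  Σv ℤ.- Σv
    ≡⟨ ℤ.+-inverseʳ Σv ⟩
  0ℤ ∎
  where
  open ≡-Reasoning
  Σv = ∑ (allVecs n) (ε ∘ dot v)

∑-character-0 : ∀ n → ∑ (allVecs n) (λ w → ε (dot (0ᵥ n) w)) ≡ ℤ.+ 2 ^ n
∑-character-0 n = begin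
  ∑ (allVecs n) (λ w → ε (dot (0ᵥ n) w)) ≡⟨ ∑-cong (allVecs n) (cong ε ∘ dot-0ˡ) ⟩
  ∑ (allVecs n) (λ _ → 1ℤ)               ≡⟨ ∑-1 (allVecs n) ⟩
  ℤ.+ length (allVecs n)                 ≡⟨ cong ℤ.+_ (length-allVecs n) ⟩
  ℤ.+ 2 ^ n                              ∎
  where open ≡-Reasoning

dot-++-take-drop : ∀ (a : Vec Bool m) (b : Vec Bool n) y → dot (a Vec.++ b) y ≡ dot a (take m y) xor dot b (drop m y)
dot-++-take-drop {m} a b y = trans (cong (dot (a Vec.++ b)) (take++drop m y)) (dot-++ a b (take m y) (drop m y))

dot-++[] : ∀ (a : Vec Bool m) (y : Vec Bool (m + 0)) → dot (a Vec.++ []) y ≡ dot a (take m y)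
dot-++[] []      []      = refl
dot-++[] (x ∷ a) (b ∷ y) = cong ((if x then b else false) xor_) (dot-++[] a y)

dot-0ᵥ++[] : ∀ {m} (y : Vec Bool (m + 0)) → dot (0ᵥ m Vec.++ []) y ≡ false
dot-0ᵥ++[] {m} y = trans (dot-++[] (0ᵥ m) y) (dot-0ˡ (take m y))

basis : ∀ t → Vec Bool t → Vec Bool (2 ^ t)
basis zero    []          = true ∷ []
basis (suc t) (false ∷ x) = basis t x Vec.++ (0ᵥ (2 ^ t) Vec.++ [])
basis (suc t) (true ∷ x)  = 0ᵥ (2 ^ t) Vec.++ (basis t x Vec.++ [])

address≡dot-basis : ∀ t z (y : Vec Bool (2 ^ t)) → address t z y ≡ dot (basis t z) y
address≡dot-basis zero    []          (a ∷ []) = sym (xor-identityʳ a)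
address≡dot-basis (suc t) (false ∷ z) y = begin
  address t z (take (2 ^ t) y)                             ≡⟨ address≡dot-basis t z _ ⟩
  front                                                    ≡⟨ xor-identityʳ front ⟨
  front xor false                                          ≡⟨ cong (front xor_) (dot-0ᵥ++[] (drop (2 ^ t) y)) ⟨
  front xor dot (0ᵥ (2 ^ t) Vec.++ []) (drop (2 ^ t) y)    ≡⟨ dot-++-take-drop (basis t z) _ y ⟨
  dot (basis (suc t) (false ∷ z)) y                        ∎
  where
  open ≡-Reasoning
  front = dot (basis t z) (take (2 ^ t) y)
address≡dot-basis (suc t) (true ∷ z) y = begin
  address t z (take (2 ^ t) (drop (2 ^ t) y))              ≡⟨ address≡dot-basis t z _ ⟩
  dot (basis t z) (take (2 ^ t) (drop (2 ^ t) y))          ≡⟨ dot-++[] (basis t z) _ ⟨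
  back                                                     ≡⟨ cong (_xor back) (dot-0ˡ (take (2 ^ t) y)) ⟨
  dot (0ᵥ (2 ^ t)) (take (2 ^ t) y) xor back               ≡⟨ dot-++-take-drop (0ᵥ (2 ^ t)) _ y ⟨
  dot (basis (suc t) (true ∷ z)) y                         ∎
  where
  open ≡-Reasoning
  back = dot (basis t z Vec.++ []) (drop (2 ^ t) y)

address-0 : ∀ t z → address t z (0ᵥ (2 ^ t)) ≡ false
address-0 t z = trans (address≡dot-basis t z _) (dot-0ʳ (basis t z))

address-⊕ : ∀ t z (u w : Vec Bool (2 ^ t)) → address t z (u ⊕ w) ≡ address t z u xor address t z w
address-⊕ t z u w = begin
  address t z (u ⊕ w)                            ≡⟨ address≡dot-basis t z _ ⟩
  dot (basis t z) (u ⊕ w)                        ≡⟨ dot-⊕ʳ (basis t z) u w ⟩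
  dot (basis t z) u xor dot (basis t z) w        ≡⟨ cong₂ _xor_ (address≡dot-basis t z u) (address≡dot-basis t z w) ⟨
  address t z u xor address t z w                ∎
  where open ≡-Reasoning

address-basis-self : ∀ t x → address t x (basis t x) ≡ true
address-basis-self zero    []          = refl
address-basis-self (suc t) (false ∷ x) =
  trans (cong (address t x) (take-++ (basis t x) _)) (address-basis-self t x)
address-basis-self (suc t) (true ∷ x)  =
  trans (cong (address t x ∘ take (2 ^ t)) (drop-++ (0ᵥ (2 ^ t)) _))
        (trans (cong (address t x) (take-++ (basis t x) [])) (address-basis-self t x))

address-basis-≢ : ∀ t {z x} → z ≢ x → address t z (basis t x) ≡ false
address-basis-≢ zero    {[]}        {[]}        z≢x = ⊥-elim (z≢x refl)
address-basis-≢ (suc t) {false ∷ z} {false ∷ x} z≢x =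
  trans (cong (address t z) (take-++ (basis t x) _)) (address-basis-≢ t (z≢x ∘ cong (false ∷_)))
address-basis-≢ (suc t) {false ∷ z} {true ∷ x}  _   =
  trans (cong (address t z) (take-++ (0ᵥ (2 ^ t)) _)) (address-0 t z)
address-basis-≢ (suc t) {true ∷ z}  {false ∷ x} _   =
  trans (cong (address t z ∘ take (2 ^ t)) (drop-++ (basis t x) _))
        (trans (cong (address t z) (take-++ (0ᵥ (2 ^ t)) [])) (address-0 t z))
address-basis-≢ (suc t) {true ∷ z}  {true ∷ x}  z≢x =
  trans (cong (address t z ∘ take (2 ^ t)) (drop-++ (0ᵥ (2 ^ t)) _))
        (trans (cong (address t z) (take-++ (basis t x) [])) (address-basis-≢ t (z≢x ∘ cong (true ∷_))))

basis≢0 : ∀ t x → basis t x ≢ 0ᵥ (2 ^ t)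
basis≢0 t x eq with trans (sym (address-basis-self t x)) (trans (cong (address t x) eq) (address-0 t x))
... | ()

-- A left inverse of basis t; its value on other vectors is irrelevant.
basisIndex : ∀ t → Vec Bool (2 ^ t) → Vec Bool t
basisIndex zero    _ = []
basisIndex (suc t) y with take (2 ^ t) y ≟v 0ᵥ (2 ^ t)
... | yes _ = true  ∷ basisIndex t (take (2 ^ t) (drop (2 ^ t) y))
... | no  _ = false ∷ basisIndex t (take (2 ^ t) y)

basisIndex-basis : ∀ t x → basisIndex t (basis t x) ≡ x
basisIndex-basis zero    []          = refl
basisIndex-basis (suc t) (false ∷ x) with take (2 ^ t) (basis (suc t) (false ∷ x)) ≟v 0ᵥ (2 ^ t)
... | yes eq = ⊥-elim (basis≢0 t x (trans (sym (take-++ (basis t x) _)) eq))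
... | no  _  = cong (false ∷_) (trans (cong (basisIndex t) (take-++ (basis t x) _)) (basisIndex-basis t x))
basisIndex-basis (suc t) (true ∷ x)  with take (2 ^ t) (basis (suc t) (true ∷ x)) ≟v 0ᵥ (2 ^ t)
... | no ne  = ⊥-elim (ne (take-++ (0ᵥ (2 ^ t)) _))
... | yes _  = cong (true ∷_) (begin
  basisIndex t (take (2 ^ t) (drop (2 ^ t) (basis (suc t) (true ∷ x))))
    ≡⟨ cong (basisIndex t ∘ take (2 ^ t)) (drop-++ (0ᵥ (2 ^ t)) _) ⟩
  basisIndex t (take (2 ^ t) (basis t x Vec.++ []))
    ≡⟨ cong (basisIndex t) (take-++ (basis t x) []) ⟩
  basisIndex t (basis t x)
    ≡⟨ basisIndex-basis t x ⟩
  x ∎)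
  where open ≡-Reasoning

basis-injective : ∀ t {x y} → basis t x ≡ basis t y → x ≡ y
basis-injective t {x} {y} eq =
  trans (sym (basisIndex-basis t x)) (trans (cong (basisIndex t) eq) (basisIndex-basis t y))

basis-⊕-cases : ∀ t {a b x y} → a ≢ b → basis t x ⊕ basis t y ≡ basis t a ⊕ basis t b → x ≡ a ⊎ y ≡ a
basis-⊕-cases t {a} {b} {x} {y} a≢b eq with x ≟v a | y ≟v a
... | yes x≡a | _       = inj₁ x≡a
... | no  _   | yes y≡a = inj₂ y≡a
... | no  x≢a | no  y≢a with begin
  false xor false
    ≡⟨ cong₂ _xor_ (address-basis-≢ t (x≢a ∘ sym)) (address-basis-≢ t (y≢a ∘ sym)) ⟨
  address t a (basis t x) xor address t a (basis t y)
    ≡⟨ address-⊕ t a _ _ ⟨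
  address t a (basis t x ⊕ basis t y)
    ≡⟨ cong (address t a) eq ⟩
  address t a (basis t a ⊕ basis t b)
    ≡⟨ address-⊕ t a _ _ ⟩
  address t a (basis t a) xor address t a (basis t b)
    ≡⟨ cong₂ _xor_ (address-basis-self t a) (address-basis-≢ t a≢b) ⟩
  true ∎
  where open ≡-Reasoning
... | ()

-- The Fourier support of ADD

fourierSum : (Vec Bool n → ℤ) → Vec Bool n → ℤ
fourierSum {n} f α = ∑ (allVecs n) (λ x → f x ℤ.* χ α x)

/≡0⇒≡0 : ∀ i n .{{_ : NonZero n}} → i / n ≡ 0ℚ → i ≡ 0ℤ
/≡0⇒≡0 i n eq = begin
  i                              ≡⟨ ℚ.↥-/ i n ⟨
  ↥ (i / n) ℤ.* gcd i (ℤ.+ n)    ≡⟨ cong (λ r → ↥ r ℤ.* gcd i (ℤ.+ n)) eq ⟩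
  0ℤ ℤ.* gcd i (ℤ.+ n)           ≡⟨ ℤ.*-zeroˡ (gcd i (ℤ.+ n)) ⟩
  0ℤ                             ∎
  where open ≡-Reasoning

∈-support⁺ : ∀ (f : Vec Bool n → ℤ) {α} → fourierSum f α ≢ 0ℤ → α ∈ support f
∈-support⁺ {n} f {α} sum≢0 =
  ∈-filter⁺ (λ β → ¬? (fhat f β ℚ.≟ 0ℚ)) (∈-allVecs α) (sum≢0 ∘ /≡0⇒≡0 _ (2 ^ n) {{m^n≢0 2 n}})

∈-support⁻ : ∀ (f : Vec Bool n → ℤ) {α} → α ∈ support f → fourierSum f α ≢ 0ℤ
∈-support⁻ {n} f α∈ sum≡0 =
  proj₂ (∈-filter⁻ (λ β → ¬? (fhat f β ℚ.≟ 0ℚ)) {xs = allVecs n} α∈)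
        (trans (cong (λ i → (i / 2 ^ n) {{m^n≢0 2 n}}) sum≡0) (ℚ.0/n≡0 (2 ^ n) {{m^n≢0 2 n}}))

fourierSum-ADD : ∀ t (A : Vec Bool t) (U : Vec Bool (2 ^ t)) →
                 fourierSum (ADD t) (A Vec.++ U)
                   ≡ ∑ (allVecs t) (λ u → ε (dot A u) ℤ.* ∑ (allVecs (2 ^ t)) (λ w → ε (dot (basis t u ⊕ U) w)))
fourierSum-ADD t A U = begin
  fourierSum (ADD t) (A Vec.++ U)
    ≡⟨ ∑-allVecs-+ t (2 ^ t) _ ⟩
  ∑ (allVecs t) (λ u → ∑ (allVecs (2 ^ t)) (λ w → ADD t (u Vec.++ w) ℤ.* χ (A Vec.++ U) (u Vec.++ w)))
    ≡⟨ ∑-cong (allVecs t) (λ u → trans (∑-cong (allVecs (2 ^ t)) (summand u))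
                                        (∑-*ˡ (allVecs (2 ^ t)) (ε (dot A u)) _)) ⟩
  ∑ (allVecs t) (λ u → ε (dot A u) ℤ.* ∑ (allVecs (2 ^ t)) (λ w → ε (dot (basis t u ⊕ U) w)))
    ∎
  where
  open ≡-Reasoning
  summand : ∀ u w → ADD t (u Vec.++ w) ℤ.* χ (A Vec.++ U) (u Vec.++ w) ≡ ε (dot A u) ℤ.* ε (dot (basis t u ⊕ U) w)
  summand u w = begin
    ADD t (u Vec.++ w) ℤ.* χ (A Vec.++ U) (u Vec.++ w)
      ≡⟨ cong₂ ℤ._*_ (cong₂ (λ x y → ε (address t x y)) (take-++ u w) (drop-++ u w)) (cong ε (dot-++ A U u w)) ⟩
    ε (address t u w) ℤ.* ε (dot A u xor dot U w)
      ≡⟨ cong₂ ℤ._*_ (cong ε (address≡dot-basis t u w)) (ε-xor (dot A u) (dot U w)) ⟩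
    ε (dot (basis t u) w) ℤ.* (ε (dot A u) ℤ.* ε (dot U w))
      ≡⟨ x∙yz≈y∙xz (ε (dot (basis t u) w)) (ε (dot A u)) (ε (dot U w)) ⟩
    ε (dot A u) ℤ.* (ε (dot (basis t u) w) ℤ.* ε (dot U w))
      ≡⟨ cong (ε (dot A u) ℤ.*_) (ε-xor (dot (basis t u) w) (dot U w)) ⟨
    ε (dot A u) ℤ.* ε (dot (basis t u) w xor dot U w)
      ≡⟨ cong (λ b → ε (dot A u) ℤ.* ε b) (dot-⊕ˡ (basis t u) U w) ⟨
    ε (dot A u) ℤ.* ε (dot (basis t u ⊕ U) w)
      ∎

⟪_,_⟫ : ∀ {t} → Vec Bool t → Vec Bool t → Vec Bool (t + 2 ^ t)
⟪ A , x ⟫ = A Vec.++ basis _ x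

slot : ∀ t → Vec Bool (t + 2 ^ t) → Vec Bool t
slot t α = basisIndex t (drop t α)

support-ADD⁺ : ∀ {t} (A x : Vec Bool t) → ⟪ A , x ⟫ ∈ support (ADD t)
support-ADD⁺ {t} A x = ∈-support⁺ (ADD t) (λ sum≡0 → ε*≢0 (dot A x) (2 ^ 2 ^ t) {{m^n≢0 2 (2 ^ t)}} (begin
  ε (dot A x) ℤ.* ℤ.+ 2 ^ 2 ^ t                     ≡⟨ cong (ε (dot A x) ℤ.*_) inner-x ⟨
  ε (dot A x) ℤ.* inner x                         ≡⟨ ∑-single (allVecs-unique t) (∈-allVecs x) inner-≢x ⟨
  ∑ (allVecs t) (λ u → ε (dot A u) ℤ.* inner u)   ≡⟨ fourierSum-ADD t A (basis t x) ⟨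
  fourierSum (ADD t) ⟪ A , x ⟫                    ≡⟨ sum≡0 ⟩
  0ℤ                                              ∎))
  where
  open ≡-Reasoning
  inner : Vec Bool t → ℤ
  inner u = ∑ (allVecs (2 ^ t)) (λ w → ε (dot (basis t u ⊕ basis t x) w))

  inner-x : inner x ≡ ℤ.+ 2 ^ 2 ^ t
  inner-x = trans (∑-cong (allVecs (2 ^ t)) (λ w → cong (λ v → ε (dot v w)) (⊕-self (basis t x))))
                  (∑-character-0 (2 ^ t))

  inner-≢x : ∀ u → u ≢ x → ε (dot A u) ℤ.* inner u ≡ 0ℤ
  inner-≢x u u≢x = trans (cong (ε (dot A u) ℤ.*_) (∑-character _ (u≢x ∘ basis-injective t ∘ ⊕≡0⇒≡)))
                         (ℤ.*-zeroʳ (ε (dot A u)))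

support-ADD⁻ : ∀ t {α} → α ∈ support (ADD t) → α ≡ ⟪ take t α , slot t α ⟫
support-ADD⁻ t {α} α∈ with drop t α ≟v basis t (slot t α)
... | yes eq = trans (take++drop t α) (cong (take t α Vec.++_) eq)
... | no  ne = ⊥-elim (∈-support⁻ (ADD t) α∈ (begin
  fourierSum (ADD t) α
    ≡⟨ cong (fourierSum (ADD t)) (take++drop t α) ⟩
  fourierSum (ADD t) (take t α Vec.++ drop t α)
    ≡⟨ fourierSum-ADD t (take t α) (drop t α) ⟩
  ∑ (allVecs t) (λ u → ε (dot (take t α) u) ℤ.* ∑ (allVecs (2 ^ t)) (λ w → ε (dot (basis t u ⊕ drop t α) w)))
    ≡⟨ ∑-zero (allVecs t) (λ {u} _ → trans (cong (ε (dot (take t α) u) ℤ.*_) (∑-character _ (not-basis u ∘ ⊕≡0⇒≡)))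
                                            (ℤ.*-zeroʳ (ε (dot (take t α) u)))) ⟩
  0ℤ ∎))
  where
  open ≡-Reasoning
  not-basis : ∀ u → basis t u ≢ drop t α
  not-basis u eq = ne (trans (sym eq) (cong (basis t) (sym (trans (cong (basisIndex t) (sym eq)) (basisIndex-basis t u)))))

-- Collisions in the Fourier support of ADD

⟪⟫-injective : ∀ {t} {A x B y : Vec Bool t} → ⟪ A , x ⟫ ≡ ⟪ B , y ⟫ → A ≡ B × x ≡ y
⟪⟫-injective {A = A} {B = B} eq = Vec.++-injectiveˡ A B eq , basis-injective _ (Vec.++-injectiveʳ A B eq)

⟪⟫-⊕ : ∀ {t} (A x B y : Vec Bool t) → ⟪ A , x ⟫ ⊕ ⟪ B , y ⟫ ≡ (A ⊕ B) Vec.++ (basis t x ⊕ basis t y)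
⟪⟫-⊕ {t} A x B y = ++-⊕ A (basis t x) B (basis t y)

module _ (t : ℕ) where

  private
    S = support (ADD t)
    Pair = Vec Bool (t + 2 ^ t) × Vec Bool (t + 2 ^ t)

  support-ADD-unique : Unique S
  support-ADD-unique = Unique.filter⁺ _ (allVecs-unique (t + 2 ^ t))

  support-ADD-≡ : ∀ {α β} → α ∈ S → β ∈ S → take t α ≡ take t β → slot t α ≡ slot t β → α ≡ β
  support-ADD-≡ {α} {β} α∈ β∈ A≡B x≡y = begin
    α                          ≡⟨ support-ADD⁻ t α∈ ⟩
    ⟪ take t α , slot t α ⟫    ≡⟨ cong₂ ⟪_,_⟫ A≡B x≡y ⟩
    ⟪ take t β , slot t β ⟫    ≡⟨ support-ADD⁻ t β∈ ⟨
    β                          ∎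
    where open ≡-Reasoning

  support-ADD-⊕ : ∀ {α β} → α ∈ S → β ∈ S →
                  α ⊕ β ≡ (take t α ⊕ take t β) Vec.++ (basis t (slot t α) ⊕ basis t (slot t β))
  support-ADD-⊕ {α} {β} α∈ β∈ =
    trans (cong₂ _⊕_ (support-ADD⁻ t α∈) (support-ADD⁻ t β∈))
          (⟪⟫-⊕ (take t α) (slot t α) (take t β) (slot t β))

  O-size-≥-sameSlot : ∀ {α β} → α ∈ S → β ∈ S → α ≢ β → slot t α ≡ slot t β →
                      2 ^ t ≤ O-size (ADD t) (α ⊕ β)
  O-size-≥-sameSlot {α} {β} α∈ β∈ α≢β same =
    subst (_≤ O-size (ADD t) (α ⊕ β)) (length-allVecs t)
      (length-filter-unorderedPairs-≥ support-ADD-unique (λ p → (proj₁ p ⊕ proj₂ p) ≟v (α ⊕ β)) g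
         (allVecs-unique t) g-injective g-unswapped (λ c → support-ADD⁺ A c , support-ADD⁺ B c)
         sum-g (λ {p} sum → trans (⊕-comm (proj₂ p) (proj₁ p)) sum))
    where
    open ≡-Reasoning
    A = take t α
    B = take t β

    g : Vec Bool t → Pair
    g c = ⟪ A , c ⟫ , ⟪ B , c ⟫

    g-injective : ∀ {c d} → g c ≡ g d → c ≡ d
    g-injective eq = proj₂ (⟪⟫-injective (cong proj₁ eq))

    g-unswapped : ∀ c d → g c ≢ swap (g d)
    g-unswapped c d eq = α≢β (support-ADD-≡ α∈ β∈ (proj₁ (⟪⟫-injective (cong proj₁ eq))) same)

    sum-g : ∀ c → proj₁ (g c) ⊕ proj₂ (g c) ≡ α ⊕ β
    sum-g c = begin
      ⟪ A , c ⟫ ⊕ ⟪ B , c ⟫                                      ≡⟨ ⟪⟫-⊕ A c B c ⟩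
      (A ⊕ B) Vec.++ (basis t c ⊕ basis t c)                     ≡⟨ cong ((A ⊕ B) Vec.++_) (⊕-self (basis t c)) ⟩
      (A ⊕ B) Vec.++ 0ᵥ (2 ^ t)                                   ≡⟨ cong ((A ⊕ B) Vec.++_) (⊕-self (basis t (slot t β))) ⟨
      (A ⊕ B) Vec.++ (basis t (slot t β) ⊕ basis t (slot t β))   ≡⟨ cong (λ x → (A ⊕ B) Vec.++ (basis t x ⊕ _)) same ⟨
      (A ⊕ B) Vec.++ (basis t (slot t α) ⊕ basis t (slot t β))   ≡⟨ support-ADD-⊕ α∈ β∈ ⟨
      α ⊕ β                                                      ∎

  O-size-≡-distinctSlot : ∀ {α β} → α ∈ S → β ∈ S → slot t α ≢ slot t β →
                          O-size (ADD t) (α ⊕ β) ≡ 2 ^ t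
  O-size-≡-distinctSlot {α} {β} α∈ β∈ a≢b = ≤-antisym
    (subst (O-size (ADD t) (α ⊕ β) ≤_) (length-allVecs t)
       (length-filter-unorderedPairs-≤ support-ADD-unique P? g h ∈-allVecs parametrised))
    (subst (_≤ O-size (ADD t) (α ⊕ β)) (length-allVecs t)
       (length-filter-unorderedPairs-≥ support-ADD-unique P? g
          (allVecs-unique t) g-injective g-unswapped (λ c → support-ADD⁺ c a , support-ADD⁺ (c ⊕ D) b)
          sum-g (λ {p} sum → trans (⊕-comm (proj₂ p) (proj₁ p)) sum)))
    where
    open ≡-Reasoning
    γ = α ⊕ β
    P? = λ (p : Pair) → (proj₁ p ⊕ proj₂ p) ≟v γ
    a = slot t α
    b = slot t β
    D = take t α ⊕ take t β

    g : Vec Bool t → Pair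
    g T = ⟪ T , a ⟫ , ⟪ T ⊕ D , b ⟫

    g-injective : ∀ {c d} → g c ≡ g d → c ≡ d
    g-injective eq = proj₁ (⟪⟫-injective (cong proj₁ eq))

    g-unswapped : ∀ c d → g c ≢ swap (g d)
    g-unswapped c d eq = a≢b (proj₂ (⟪⟫-injective (cong proj₁ eq)))

    sum-g : ∀ T → proj₁ (g T) ⊕ proj₂ (g T) ≡ γ
    sum-g T = begin
      ⟪ T , a ⟫ ⊕ ⟪ T ⊕ D , b ⟫                        ≡⟨ ⟪⟫-⊕ T a (T ⊕ D) b ⟩
      (T ⊕ (T ⊕ D)) Vec.++ (basis t a ⊕ basis t b)     ≡⟨ cong (Vec._++ (basis t a ⊕ basis t b)) (u⊕[u⊕w]≡w T D) ⟩
      D Vec.++ (basis t a ⊕ basis t b)                 ≡⟨ support-ADD-⊕ α∈ β∈ ⟨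
      γ                                                ∎

    h : Pair → Vec Bool t
    h (p₁ , p₂) with slot t p₁ ≟v a
    ... | yes _ = take t p₁
    ... | no  _ = take t p₂

    determined : ∀ {p₁ p₂} → p₁ ∈ S → p₁ ⊕ p₂ ≡ γ → slot t p₁ ≡ a → (p₁ , p₂) ≡ g (take t p₁)
    determined {p₁} {p₂} p₁∈ sum p₁-a =
      cong₂ _,_ p₁≡ (⊕-cancelˡ-≡ (begin
        p₁ ⊕ p₂                                   ≡⟨ sum ⟩
        γ                                         ≡⟨ sum-g (take t p₁) ⟨
        ⟪ take t p₁ , a ⟫ ⊕ ⟪ take t p₁ ⊕ D , b ⟫  ≡⟨ cong (_⊕ ⟪ take t p₁ ⊕ D , b ⟫) p₁≡ ⟨
        p₁ ⊕ ⟪ take t p₁ ⊕ D , b ⟫                 ∎))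
      where
      p₁≡ : p₁ ≡ ⟪ take t p₁ , a ⟫
      p₁≡ = trans (support-ADD⁻ t p₁∈) (cong ⟪ take t p₁ ,_⟫ p₁-a)

    slot-cases : ∀ {p₁ p₂} → p₁ ∈ S → p₂ ∈ S → p₁ ⊕ p₂ ≡ γ → slot t p₁ ≡ a ⊎ slot t p₂ ≡ a
    slot-cases {p₁} {p₂} p₁∈ p₂∈ sum = basis-⊕-cases t a≢b
      (Vec.++-injectiveʳ (take t p₁ ⊕ take t p₂) D
        (trans (sym (support-ADD-⊕ p₁∈ p₂∈)) (trans sum (support-ADD-⊕ α∈ β∈))))

    parametrised : ∀ {p} → p ∈ filter P? (unorderedPairs S) → p ≈ᵤ g (h p)
    parametrised {p₁ , p₂} p∈ with ∈-filter⁻ P? {xs = unorderedPairs S} p∈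
    ... | p∈S² , sum with ∈-unorderedPairs⁻ p∈S² | slot t p₁ ≟v a
    ...   | p₁∈ , _   | yes p₁-a = inj₁ (determined p₁∈ sum p₁-a)
    ...   | p₁∈ , p₂∈ | no  p₁≢a with slot-cases p₁∈ p₂∈ sum
    ...     | inj₁ p₁-a = ⊥-elim (p₁≢a p₁-a)
    ...     | inj₂ p₂-a = inj₂ (cong swap (determined p₂∈ (trans (⊕-comm p₂ p₁) sum) p₂-a))

  sparsity-ADD-≥ : 2 ^ (t + t) ≤ sparsity (ADD t)
  sparsity-ADD-≥ = subst (_≤ sparsity (ADD t)) (length-allVecs (t + t))
    (length-≤-injectiveOn (λ v → ⟪ take t v , drop t v ⟫) (allVecs-unique (t + t)) (λ _ _ → injective)
       (λ {v} _ → support-ADD⁺ (take t v) (drop t v)))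
    where
    injective : ∀ {v w : Vec Bool (t + t)} → ⟪ take t v , drop t v ⟫ ≡ ⟪ take t w , drop t w ⟫ → v ≡ w
    injective {v} {w} eq = begin
      v                          ≡⟨ take++drop t v ⟩
      take t v Vec.++ drop t v   ≡⟨ cong₂ Vec._++_ (proj₁ (⟪⟫-injective {t} eq)) (proj₂ (⟪⟫-injective {t} eq)) ⟩
      take t w Vec.++ drop t w   ≡⟨ take++drop t w ⟨
      w                          ∎
      where open ≡-Reasoning

  length-filter-sameSlot-≤ : ∀ {Q : Pair → Set} (Q? : Decidable Q) →
                             (∀ {p} → p ∈ unorderedPairs S → Q p → slot t (proj₁ p) ≡ slot t (proj₂ p)) →
                             length (filter Q? (unorderedPairs S)) ≤ 2 ^ (t + (t + t))
  length-filter-sameSlot-≤ Q? sameSlot =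
    subst (length (filter Q? (unorderedPairs S)) ≤_) (length-allVecs (t + (t + t)))
      (length-≤-injectiveOn code (Unique.filter⁺ Q? (unorderedPairs-unique support-ADD-unique))
         injective (λ _ → ∈-allVecs _))
    where
    code : Pair → Vec Bool (t + (t + t))
    code (p₁ , p₂) = take t p₁ Vec.++ (take t p₂ Vec.++ slot t p₁)

    injective : ∀ {p q} → p ∈ filter Q? (unorderedPairs S) → q ∈ filter Q? (unorderedPairs S) →
                code p ≡ code q → p ≡ q
    injective {p₁ , p₂} {q₁ , q₂} p∈ q∈ eq
      with ∈-filter⁻ Q? {xs = unorderedPairs S} p∈ | ∈-filter⁻ Q? {xs = unorderedPairs S} q∈
    ... | p∈S² , Qp | q∈S² , Qq with ∈-unorderedPairs⁻ p∈S² | ∈-unorderedPairs⁻ q∈S²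
    ...   | p₁∈ , p₂∈ | q₁∈ , q₂∈ = cong₂ _,_
      (support-ADD-≡ p₁∈ q₁∈ take₁ slot₁)
      (support-ADD-≡ p₂∈ q₂∈ take₂ (trans (sym (sameSlot p∈S² Qp)) (trans slot₁ (sameSlot q∈S² Qq))))
      where
      rest = Vec.++-injectiveʳ (take t p₁) (take t q₁) eq
      take₁ = Vec.++-injectiveˡ (take t p₁) (take t q₁) eq
      take₂ = Vec.++-injectiveˡ (take t p₂) (take t q₂) rest
      slot₁ = Vec.++-injectiveʳ (take t p₂) (take t q₂) rest

n≤2^n : ∀ n → n ≤ 2 ^ n
n≤2^n zero    = z≤n
n≤2^n (suc n) = begin
  1 + n           ≤⟨ +-mono-≤ (m^n>0 2 n) (n≤2^n n) ⟩
  2 ^ n + 2 ^ n   ≡⟨ cong ((2 ^ n) +_) (+-identityʳ (2 ^ n)) ⟨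
  2 ^ suc n       ∎
  where open ≤-Reasoning

2*nC2+n≡n*n : ∀ n → 2 * (n C 2) + n ≡ n * n
2*nC2+n≡n*n zero    = refl
2*nC2+n≡n*n (suc n) = begin
  2 * (suc n C 2) + suc n        ≡⟨ cong (λ c → 2 * c + suc n) (nCk+nC[k+1]≡[n+1]C[k+1] n 1) ⟨
  2 * (n C 1 + n C 2) + suc n    ≡⟨ cong (λ c → 2 * (c + n C 2) + suc n) (nC1≡n n) ⟩
  2 * (n + n C 2) + suc n        ≡⟨ solve 2 (λ n c → con 2 :* (n :+ c) :+ (con 1 :+ n)
                                                  := (con 2 :* c :+ n) :+ (con 1 :+ con 2 :* n)) refl n (n C 2) ⟩
  (2 * (n C 2) + n) + (1 + 2 * n) ≡⟨ cong (_+ (1 + 2 * n)) (2*nC2+n≡n*n n) ⟩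
  n * n + (1 + 2 * n)            ≡⟨ solve 1 (λ n → n :* n :+ (con 1 :+ con 2 :* n)
                                                := (con 1 :+ n) :* (con 1 :+ n)) refl n ⟩
  suc n * suc n                  ∎
  where open ≡-Reasoning

-- k² = 2·C(k,2) + k ≤ 2P³D + k, whereas k² ≥ kP² ≥ kP(2D + 2) ≥ 2P³D + 2k.
m*D<kC2 : ∀ {P D k m} → 2 * D + 2 ≤ P → P * P ≤ k → m ≤ P * (P * P) → m * D < k C 2
m*D<kC2 {P} {D} {k} {m} P≥ k≥ m≤ = ≰⇒> λ kC2≤ →
  <⇒≱ (m<m+n k 1≤k) (+-cancelˡ-≤ (2 * P³D) (k + k) k (≤-trans lower (upper kC2≤)))
  where
  P³D = P * (P * P) * D

  1≤P : 1 ≤ P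
  1≤P = ≤-trans (m≤n+m 1 (2 * D + 1)) (≤-trans (≤-reflexive (+-assoc (2 * D) 1 1)) P≥)

  1≤k : 1 ≤ k
  1≤k = ≤-trans (*-mono-≤ 1≤P 1≤P) k≥

  k≤k*P : k ≤ k * P
  k≤k*P = ≤-trans (≤-reflexive (sym (*-identityʳ k))) (*-monoʳ-≤ k 1≤P)

  upper : k C 2 ≤ m * D → k * k ≤ 2 * P³D + k
  upper kC2≤ = begin
    k * k              ≡⟨ 2*nC2+n≡n*n k ⟨
    2 * (k C 2) + k    ≤⟨ +-monoˡ-≤ k (*-monoʳ-≤ 2 (≤-trans kC2≤ (*-monoˡ-≤ D m≤))) ⟩
    2 * P³D + k        ∎
    where open ≤-Reasoning

  lower : 2 * P³D + (k + k) ≤ k * k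
  lower = begin
    2 * P³D + (k + k)               ≡⟨ solve 3 (λ P D k → con 2 :* ((P :* (P :* P)) :* D) :+ (k :+ k)
                                                 := ((P :* P) :* P) :* (con 2 :* D) :+ k :* con 2) refl P D k ⟩
    P * P * P * (2 * D) + k * 2     ≤⟨ +-mono-≤ (*-monoˡ-≤ (2 * D) (*-monoˡ-≤ P k≥)) (*-monoˡ-≤ 2 k≤k*P) ⟩
    k * P * (2 * D) + k * P * 2     ≡⟨ *-distribˡ-+ (k * P) (2 * D) 2 ⟨
    k * P * (2 * D + 2)             ≤⟨ *-monoʳ-≤ (k * P) P≥ ⟩
    k * P * P                       ≡⟨ *-assoc k P P ⟩
    k * (P * P)                     ≤⟨ *-monoʳ-≤ k k≥ ⟩
    k * k                           ∎
    where open ≤-Reasoning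

δ*c≤m⇒c≤m*↧δ : ∀ δ → 0ℚ <ℚ δ → ∀ c m → δ ℚ.* (ℤ.+ c ℚ./ 1) ℚ.≤ ℤ.+ m ℚ./ 1 → c ≤ m * ↧ₙ δ
δ*c≤m⇒c≤m*↧δ (mkℚ (ℤ.+ zero)  _ _) (ℚ.*<* (ℤ.+<+ ())) _ _ _
δ*c≤m⇒c≤m*↧δ (mkℚ ℤ.-[1+ _ ]  _ _) (ℚ.*<* ())         _ _ _
δ*c≤m⇒c≤m*↧δ δ@(mkℚ (ℤ.+ suc n) d _) _ c m δc≤m with unnormalised
  where
  unnormalised : toℚᵘ δ ℚᵘ.* mkℚᵘ (ℤ.+ c) 0 ℚᵘ.≤ mkℚᵘ (ℤ.+ m) 0
  unnormalised =
    ℚᵘ.≤-respʳ-≃ (ℚ.toℚᵘ-fromℚᵘ (mkℚᵘ (ℤ.+ m) 0))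
      (ℚᵘ.≤-respˡ-≃ (ℚᵘ.*-congˡ {toℚᵘ δ} (ℚ.toℚᵘ-fromℚᵘ (mkℚᵘ (ℤ.+ c) 0)))
        (ℚᵘ.≤-respˡ-≃ (ℚ.toℚᵘ-homo-* δ (ℤ.+ c ℚ./ 1)) (ℚ.toℚᵘ-mono-≤ δc≤m)))
... | *≤* nc≤md = begin
  c                   ≤⟨ m≤n*m c (suc n) ⟩
  suc n * c           ≤⟨ ℤ.drop‿+≤+ (subst₂ ℤ._≤_ (trans (ℤ.*-identityʳ _) (sym (ℤ.pos-* (suc n) c)))
                                                   (sym (ℤ.pos-* m (suc d * 1))) nc≤md) ⟩
  m * (suc d * 1)     ≡⟨ cong (m *_) (*-identityʳ (suc d)) ⟩
  m * suc d           ∎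
  where open ≤-Reasoning

[o∸1]^q<k^p : ∀ {o P k} p q → 1 ≤ q → q ≤ 2 * p → 1 ≤ P → o ≤ P → P * P ≤ k → (o ∸ 1) ^ q < k ^ p
[o∸1]^q<k^p {o} {P@(suc _)} {k} p q@(suc _) _ q≤2p (s≤s z≤n) o≤P P*P≤k = begin-strict
  (o ∸ 1) ^ q   <⟨ ^-monoˡ-< q (s≤s (∸-monoˡ-≤ 1 o≤P)) ⟩
  P ^ q         ≤⟨ ^-monoʳ-≤ P q≤2p ⟩
  P ^ (2 * p)   ≡⟨ ^-*-assoc P 2 p ⟨
  (P ^ 2) ^ p   ≡⟨ cong (λ x → (P * x) ^ p) (*-identityʳ P) ⟩
  (P * P) ^ p   ≤⟨ ^-monoˡ-≤ p P*P≤k ⟩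
  k ^ p         ∎
  where open ≤-Reasoning

O-size-ADD-≥ : ∀ t {α β} → α ∈ support (ADD t) → β ∈ support (ADD t) → α ≢ β →
               2 ^ t ≤ O-size (ADD t) (α ⊕ β)
O-size-ADD-≥ t α∈ β∈ α≢β with slot t _ ≟v slot t _
... | yes same = O-size-≥-sameSlot t α∈ β∈ α≢β same
... | no  diff = ≤-reflexive (sym (O-size-≡-distinctSlot t α∈ β∈ diff))

ADD-folding : ∀ t → FoldingWith (ADD t) 1ℚ (λ o → 2 ^ t ≤ o) (λ o → 2 ^ t ≤? o)
ADD-folding t = subst (λ n → 1ℚ ℚ.* (ℤ.+ (sparsity (ADD t) C 2) ℚ./ 1) ℚ.≤ ℤ.+ n ℚ./ 1) (sym all-big)
  (ℚ.≤-reflexive (ℚ.*-identityˡ _))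
  where
  all-big : length (filter (λ p → 2 ^ t ≤? O-size (ADD t) (proj₁ p ⊕ proj₂ p)) (unorderedPairs (support (ADD t))))
            ≡ sparsity (ADD t) C 2
  all-big = trans (cong length (filter-all _ (All.tabulate λ p∈ →
      let (p₁∈ , p₂∈) = ∈-unorderedPairs⁻ p∈ in
      O-size-ADD-≥ t p₁∈ p₂∈ (unorderedPairs-irreflexive (support-ADD-unique t) p∈))))
    (length-unorderedPairs (support (ADD t)))

ADD-not-folding : ∀ δ → 0ℚ <ℚ δ → ∀ p q → 1 ≤ q → q ≤ 2 * p →
                  ∀ t → 2 * ↧ₙ δ + 2 ≤ 2 ^ t → ¬ Folding (ADD t) δ p q
ADD-not-folding δ δ>0 p q q≥1 q≤2p t large folding =
  <⇒≱ (m*D<kC2 {D = ↧ₙ δ} large P*P≤k big-pairs-≤) (δ*c≤m⇒c≤m*↧δ δ δ>0 (k C 2) big-pairs folding)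
  where
  k = sparsity (ADD t)
  S = support (ADD t)

  P*P≤k : 2 ^ t * 2 ^ t ≤ k
  P*P≤k = subst (_≤ k) (^-distribˡ-+-* 2 t t) (sparsity-ADD-≥ t)

  Big? = λ r → k ^ p ≤? (O-size (ADD t) (proj₁ r ⊕ proj₂ r) ∸ 1) ^ q
  big-pairs = length (filter Big? (unorderedPairs S))

  big⇒sameSlot : ∀ {r} → r ∈ unorderedPairs S → k ^ p ≤ (O-size (ADD t) (proj₁ r ⊕ proj₂ r) ∸ 1) ^ q →
                 slot t (proj₁ r) ≡ slot t (proj₂ r)
  big⇒sameSlot r∈ big with slot t _ ≟v slot t _ | ∈-unorderedPairs⁻ r∈
  ... | yes same | _         = same
  ... | no  diff | r₁∈ , r₂∈ = ⊥-elim (<⇒≱ ([o∸1]^q<k^p p q q≥1 q≤2p (m^n>0 2 t)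
                                   (≤-reflexive (O-size-≡-distinctSlot t r₁∈ r₂∈ diff)) P*P≤k) big)

  big-pairs-≤ : big-pairs ≤ 2 ^ t * (2 ^ t * 2 ^ t)
  big-pairs-≤ = subst (big-pairs ≤_)
    (trans (^-distribˡ-+-* 2 t (t + t)) (cong (2 ^ t *_) (^-distribˡ-+-* 2 t t)))
    (length-filter-sameSlot-≤ t Big? big⇒sameSlot)

claim6 : (∀ (t : ℕ) →
              (∀ (α β : Vec Bool (t + 2 ^ t)) → α ∈ support (ADD t) → β ∈ support (ADD t) → α ≢ β →
                 2 ^ t ≤ O-size (ADD t) (α ⊕ β))
              × FoldingWith (ADD t) 1ℚ (λ o → 2 ^ t ≤ o) (λ o → 2 ^ t ≤? o))
         × (∀ (δ : ℚ) → 0ℚ <ℚ δ → ∀ (p q : ℕ) → 1 ≤ q → q ≤ 2 * p →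
              ∃[ t₀ ] (∀ (t : ℕ) → t₀ ≤ t → ¬ Folding (ADD t) δ p q))
claim6 = (λ t → (λ α β → O-size-ADD-≥ t) , ADD-folding t)
       , λ δ δ>0 p q q≥1 q≤2p → 2 * ↧ₙ δ + 2 ,
           λ t t₀≤t → ADD-not-folding δ δ>0 p q q≥1 q≤2p t (≤-trans t₀≤t (n≤2^n t))
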